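{- Let $G$ be a cograph and let $0\le\varepsilon\le 1$. Then there exist $X,Y\subseteq V(G)$ such that $G[X]$ and $\overline{G}[Y]$ both have maximum degree at most $\varepsilon|G|$, and $|X|\cdot|Y|\ge \varepsilon|G|^2$.
   Context: All graphs are finite and simple; $|G|$ is the number of vertices, $G[X]$ the induced subgraph on $X$, $\overline{G}$ the complement. A cograph is a graph with no induced subgraph isomorphic to $P_4$, the path on four vertices.
   Formalization: The parameter ε takes only rational values with $0\le\varepsilon\le 1$. -}

module Defs where

open import Data.Nat using (ℕ; zero; suc; _+_; _*_; _≤_)
open import Data.Bool using (Bool; true; false; not; _∧_; if_then_else_)
open import Data.Fin using (Fin; zero; suc; _≟_)
open import Data.Fin.Subset using (Subset; ∣_∣)
open import Data.Vec using (lookup)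
open import Data.Empty using (⊥)
open import Relation.Nullary.Decidable using (⌊_⌋)
open import Relation.Binary.PropositionalEquality using (_≡_; refl; cong₂) renaming (sym to ≡sym)
open import Relation.Nullary using (yes; no)
open import Data.Empty using (⊥-elim)
open import Data.Bool.Properties using (∧-zeroʳ)

record Graph (n : ℕ) : Set where
  field
    adj    : Fin n → Fin n → Bool
    sym    : ∀ u v → adj u v ≡ adj v u
    irrefl : ∀ v → adj v v ≡ false
open Graph public

count : {n : ℕ} → (Fin n → Bool) → ℕ
count {zero}  f = 0
count {suc n} f = (if f zero then 1 else 0) + count (λ i → f (suc i))

complement : {n : ℕ} → Graph n → Graph n
complement G = record
  { adj    = λ u v → not (adj G u v) ∧ not ⌊ u ≟ v ⌋
  ; sym    = λ u v → cong₂ (λ a b → not a ∧ not b) (sym G u v) (≟-sym u v)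
  ; irrefl = λ v → irr v
  }
  where
  ≟-sym : ∀ {n} (u v : Fin n) → ⌊ u ≟ v ⌋ ≡ ⌊ v ≟ u ⌋
  ≟-sym u v with u ≟ v | v ≟ u
  ... | yes _ | yes _ = refl
  ... | yes p | no q = ⊥-elim (q (≡sym p))
  ... | no q | yes p = ⊥-elim (q (≡sym p))
  ... | no _ | no _ = refl
  irr : ∀ v → (not (adj G v v) ∧ not ⌊ v ≟ v ⌋) ≡ false
  irr v with v ≟ v
  ... | yes _ = ∧-zeroʳ (not (adj G v v))
  ... | no ¬p = ⊥-elim (¬p refl)

Cograph : {n : ℕ} → Graph n → Set
Cograph {n} G = (a b c d : Fin n) →
  adj G a b ≡ true → adj G b c ≡ true → adj G c d ≡ true →
  adj G a c ≡ false → adj G b d ≡ false → adj G a d ≡ false → ⊥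

degIn : {n : ℕ} → Graph n → Subset n → Fin n → ℕ
degIn G X v = count (λ u → lookup X u ∧ adj G v u)

-- G[X] has maximum degree at most (p/q)·|G|, i.e. q·deg ≤ p·n for all v ∈ X
MaxDegAtMost : {n : ℕ} → Graph n → Subset n → ℕ → ℕ → Set
MaxDegAtMost {n} G X p q = ∀ v → lookup X v ≡ true → q * degIn G X v ≤ p * n

-- Every vertex set S, |S| ≥ 2, of a cograph splits into two nonempty parts with
-- no edges between them, either in the graph or in its complement; the
-- complement of a cograph is again a cograph, so the two graphs play symmetric
-- roles. The split is built by adding one vertex v to a split of S − v: either
-- one side contains no neighbour of v and stays split off, or the side holding a
-- non-neighbour of v shrinks to its non-neighbours of v, since an edge leaving it
-- would create an induced P₄.
--
-- Put d = ⌊εn⌋ and m = min(n, d + 1) ≥ εn. Induction on |S| shows that every S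
-- with |S| ≥ m contains X, Y with Δ(G[X]), Δ(Ḡ[Y]) ≤ d and m|S| ≤ |X||Y|. If |S| ≤ d + 1 take
-- X = Y = S. Otherwise split S = S₁ ⊔ S₂ with, say, no G-edges across; a part
-- with |Sᵢ| ≥ m yields (Xᵢ, Yᵢ) by induction, a smaller one takes Xᵢ = Sᵢ and
-- for Yᵢ any m vertices of S. Then X = X₁ ∪ X₂ keeps its degrees, Y is the
-- larger Yᵢ, and m|S| = m|S₁| + m|S₂| ≤ (|X₁| + |X₂|)|Y|. Finally
-- εn² ≤ mn ≤ |X||Y|.

module Submission where

open import Defs renaming (sym to adj-sym)
open import Data.Bool using (Bool; true; false; not; _∧_)
open import Data.Bool.Properties using (not-¬; ¬-not)
open import Data.Fin using (Fin; zero; suc; _≟_)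
open import Data.Fin.Subset
open import Data.Fin.Subset.Properties
open import Data.Nat
  using (ℕ; zero; suc; _+_; _*_; _⊓_; _≤_; _<_; _≤?_; z≤n; s≤s; s≤s⁻¹; NonZero; >-nonZero)
open import Data.Nat.Properties hiding (_≟_)
open import Data.Nat.DivMod using (_/_; _%_; m≡m%n+[m/n]*n; m%n<n; m/n*n≤m)
open import Data.Nat.Induction using (<-wellFounded)
open import Data.Product using (Σ-syntax; ∃-syntax; _×_; _,_; proj₁; proj₂)
open import Data.Sum using (_⊎_; inj₁; inj₂; swap; [_,_]′)
import Data.Sum as Sum
open import Data.Vec using ([]; _∷_; here; there; lookup; tabulate)
open import Data.Vec.Properties using (lookup∘tabulate; []=⇒lookup; lookup⇒[]=)
open import Function using (_∘_; _on_)
open import Induction.WellFounded using (WellFounded; Acc; acc)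
open import Relation.Binary.Construct.On using () renaming (wellFounded to on-wellFounded)
open import Relation.Nullary using (¬_; Dec; yes; no; contradiction)
open import Relation.Binary.PropositionalEquality

private
  variable
    n d m : ℕ
    u v w x y : Fin n
    p q r S T U : Subset n
    G : Graph n

x∈p─q⇒x∉q : ∀ (p q : Subset n) → x ∈ p ─ q → x ∉ q
x∈p─q⇒x∉q (_ ∷ p) (inside ∷ q) () here
x∈p─q⇒x∉q (_ ∷ p) (_      ∷ q) (there x∈p─q) (there x∈q) = x∈p─q⇒x∉q p q x∈p─q x∈q

x∈p∧x∉p─q⇒x∈q : ∀ q → x ∈ p → x ∉ p ─ q → x ∈ q
x∈p∧x∉p─q⇒x∈q {x = x} q x∈p x∉p─q with x ∈? q
... | yes x∈q = x∈q
... | no  x∉q = contradiction (x∈p∧x∉q⇒x∈p─q x∈p x∉q) x∉p─q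

x∈p⇒⁅x⁆⊆p : x ∈ p → ⁅ x ⁆ ⊆ p
x∈p⇒⁅x⁆⊆p {x = x} {p = p} x∈p y∈⁅x⁆ = subst (_∈ p) (sym (x∈⁅y⁆⇒x≡y x y∈⁅x⁆)) x∈p

x∈p⇒0<∣p∣ : x ∈ p → 0 < ∣ p ∣
x∈p⇒0<∣p∣ {x = x} x∈p = subst (_≤ _) (∣⁅x⁆∣≡1 x) (p⊆q⇒∣p∣≤∣q∣ (x∈p⇒⁅x⁆⊆p x∈p))

0<∣p∣⇒Nonempty : ∀ (p : Subset n) → 0 < ∣ p ∣ → Nonempty p
0<∣p∣⇒Nonempty (inside  ∷ p) _      = zero , here
0<∣p∣⇒Nonempty (outside ∷ p) 0<∣p∣ with 0<∣p∣⇒Nonempty p 0<∣p∣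
... | x , x∈p = suc x , there x∈p

p⊆q⇒∣q∣≡∣p∣+∣q─p∣ : ∀ (p q : Subset n) → p ⊆ q → ∣ q ∣ ≡ ∣ p ∣ + ∣ q ─ p ∣
p⊆q⇒∣q∣≡∣p∣+∣q─p∣ []            []            _   = refl
p⊆q⇒∣q∣≡∣p∣+∣q─p∣ (inside  ∷ p) (inside  ∷ q) p⊆q = cong suc (p⊆q⇒∣q∣≡∣p∣+∣q─p∣ p q (drop-∷-⊆ p⊆q))
p⊆q⇒∣q∣≡∣p∣+∣q─p∣ (inside  ∷ p) (outside ∷ q) p⊆q with () ← p⊆q here
p⊆q⇒∣q∣≡∣p∣+∣q─p∣ (outside ∷ p) (inside  ∷ q) p⊆q =
  trans (cong suc (p⊆q⇒∣q∣≡∣p∣+∣q─p∣ p q (drop-∷-⊆ p⊆q))) (sym (+-suc _ _))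
p⊆q⇒∣q∣≡∣p∣+∣q─p∣ (outside ∷ p) (outside ∷ q) p⊆q = p⊆q⇒∣q∣≡∣p∣+∣q─p∣ p q (drop-∷-⊆ p⊆q)

∣p∪q∣≡∣p∣+∣q∣ : ∀ (p q : Subset n) → (∀ {x} → x ∈ p → x ∉ q) → ∣ p ∪ q ∣ ≡ ∣ p ∣ + ∣ q ∣
∣p∪q∣≡∣p∣+∣q∣ []            []            _        = refl
∣p∪q∣≡∣p∣+∣q∣ (inside  ∷ p) (inside  ∷ q) disjoint = contradiction here (disjoint here)
∣p∪q∣≡∣p∣+∣q∣ (inside  ∷ p) (outside ∷ q) disjoint =
  cong suc (∣p∪q∣≡∣p∣+∣q∣ p q (λ x∈p x∈q → disjoint (there x∈p) (there x∈q)))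
∣p∪q∣≡∣p∣+∣q∣ (outside ∷ p) (inside  ∷ q) disjoint =
  trans (cong suc (∣p∪q∣≡∣p∣+∣q∣ p q (λ x∈p x∈q → disjoint (there x∈p) (there x∈q)))) (sym (+-suc _ _))
∣p∪q∣≡∣p∣+∣q∣ (outside ∷ p) (outside ∷ q) disjoint =
  ∣p∪q∣≡∣p∣+∣q∣ p q (λ x∈p x∈q → disjoint (there x∈p) (there x∈q))

x∈p⇒∣p∣≡1+∣p-x∣ : x ∈ p → ∣ p ∣ ≡ suc ∣ p - x ∣
x∈p⇒∣p∣≡1+∣p-x∣ {x = x} {p = p} x∈p
  rewrite p⊆q⇒∣q∣≡∣p∣+∣q─p∣ ⁅ x ⁆ p (x∈p⇒⁅x⁆⊆p x∈p) | ∣⁅x⁆∣≡1 x = refl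

x∈p-y⇒x≢y : ∀ p → x ∈ p - y → x ≢ y
x∈p-y⇒x≢y {y = y} p x∈p-y = x∉⁅y⁆⇒x≢y (x∈p─q⇒x∉q p ⁅ y ⁆ x∈p-y)

two-elements⇒2≤∣p∣ : u ∈ p → w ∈ p → w ≢ u → 2 ≤ ∣ p ∣
two-elements⇒2≤∣p∣ u∈p w∈p w≢u rewrite x∈p⇒∣p∣≡1+∣p-x∣ u∈p =
  s≤s (x∈p⇒0<∣p∣ (x∈p∧x≢y⇒x∈p-y w∈p w≢u))

subset-of-size : ∀ (p : Subset n) → m ≤ ∣ p ∣ → ∃[ q ] q ⊆ p × ∣ q ∣ ≡ m
subset-of-size {n} {zero} p _ = ⊥ , ⊥⊆ , ∣⊥∣≡0 n
subset-of-size {m = suc m} (inside ∷ p) m≤∣p∣ with subset-of-size p (s≤s⁻¹ m≤∣p∣)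
... | q , q⊆p , ∣q∣ = inside ∷ q , s⊆s q⊆p , cong suc ∣q∣
subset-of-size {m = suc m} (outside ∷ p) m≤∣p∣ with subset-of-size p m≤∣p∣
... | q , q⊆p , ∣q∣ = outside ∷ q , s⊆s q⊆p , ∣q∣

p⊆r∧q⊆r⇒p∪q⊆r : ∀ (p q : Subset n) → p ⊆ r → q ⊆ r → p ∪ q ⊆ r
p⊆r∧q⊆r⇒p∪q⊆r p q p⊆r q⊆r x∈p∪q = [ p⊆r , q⊆r ]′ (x∈p∪q⁻ p q x∈p∪q)

larger : ∀ {ℓ} (Q : Subset n → Set ℓ) → Q p → Q q → Σ[ r ∈ Subset n ] Q r × ∣ p ∣ ≤ ∣ r ∣ × ∣ q ∣ ≤ ∣ r ∣
larger {p = p} {q = q} Q Qp Qq with ∣ q ∣ ≤? ∣ p ∣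
... | yes ∣q∣≤∣p∣ = p , Qp , ≤-refl , ∣q∣≤∣p∣
... | no  ∣q∣≰∣p∣ = q , Qq , <⇒≤ (≰⇒> ∣q∣≰∣p∣) , ≤-refl

_≺_ : Subset n → Subset n → Set
_≺_ = _<_ on ∣_∣

≺-wellFounded : WellFounded (_≺_ {n})
≺-wellFounded = on-wellFounded ∣_∣ <-wellFounded

neighbours : Graph n → Fin n → Subset n
neighbours G v = tabulate (adj G v)

adj⇒∈neighbours : ∀ (G : Graph n) → adj G v u ≡ true → u ∈ neighbours G v
adj⇒∈neighbours {v = v} {u = u} G e = lookup⇒[]= u _ (trans (lookup∘tabulate (adj G v) u) e)

∈neighbours⇒adj : ∀ (G : Graph n) → u ∈ neighbours G v → adj G v u ≡ true
∈neighbours⇒adj {u = u} {v = v} G u∈N = trans (sym (lookup∘tabulate (adj G v) u)) ([]=⇒lookup u∈N)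

∉neighbours⇒nonadj : ∀ (G : Graph n) → u ∉ neighbours G v → adj G v u ≡ false
∉neighbours⇒nonadj G u∉N = ¬-not (u∉N ∘ adj⇒∈neighbours G)

nonadj⇒∉neighbours : ∀ (G : Graph n) → adj G v u ≡ false → u ∉ neighbours G v
nonadj⇒∉neighbours G vu = not-¬ vu ∘ ∈neighbours⇒adj G

degree : Graph n → Subset n → Fin n → ℕ
degree G p v = ∣ p ∩ neighbours G v ∣

degIn≡degree : ∀ (G : Graph n) p v → degIn G p v ≡ degree G p v
degIn≡degree G p v = go p (adj G v)
  where
  go : ∀ {k} (p : Subset k) (f : Fin k → Bool) → count (λ u → lookup p u ∧ f u) ≡ ∣ p ∩ tabulate f ∣
  go []      f = refl
  go (x ∷ p) f with x ∧ f zero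
  ... | true  = cong suc (go p (f ∘ suc))
  ... | false = go p (f ∘ suc)

MaxDegree : Graph n → Subset n → ℕ → Set
MaxDegree G p d = ∀ {v} → v ∈ p → degree G p v ≤ d

Apart : Graph n → Subset n → Subset n → Set
Apart G p q = ∀ {x y} → x ∈ p → y ∈ q → adj G x y ≡ false

Apart-sym : ∀ (G : Graph n) → Apart G p q → Apart G q p
Apart-sym G apart {x} {y} y∈q x∈p = trans (adj-sym G x y) (apart x∈p y∈q)

degree<∣p∣ : ∀ (G : Graph n) → v ∈ p → degree G p v < ∣ p ∣
degree<∣p∣ {v = v} {p = p} G v∈p = p⊂q⇒∣p∣<∣q∣ (p∩q⊆p p _ , v , v∈p , v∉p∩N)
  where
  v∉p∩N : v ∉ p ∩ neighbours G v
  v∉p∩N v∈p∩N = not-¬ (irrefl G v) (∈neighbours⇒adj G (proj₂ (x∈p∩q⁻ p _ v∈p∩N)))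

small⇒MaxDegree : ∀ (G : Graph n) → ∣ p ∣ ≤ suc d → MaxDegree G p d
small⇒MaxDegree G ∣p∣≤1+d v∈p = s≤s⁻¹ (≤-trans (degree<∣p∣ G v∈p) ∣p∣≤1+d)

degree-mono : ∀ (G : Graph n) → (∀ {u} → u ∈ r → adj G v u ≡ true → u ∈ p) → degree G r v ≤ degree G p v
degree-mono {r = r} {v = v} {p = p} G r∩N⊆p = p⊆q⇒∣p∣≤∣q∣ λ u∈r∩N →
  let u∈r , u∈N = x∈p∩q⁻ r _ u∈r∩N in x∈p∩q⁺ (r∩N⊆p u∈r (∈neighbours⇒adj G u∈N) , u∈N)

neighbour-stays : ∀ (G : Graph n) → Apart G p q → v ∈ p → u ∈ p ⊎ u ∈ q → adj G v u ≡ true → u ∈ p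
neighbour-stays G apart v∈p (inj₁ u∈p) _  = u∈p
neighbour-stays G apart v∈p (inj₂ u∈q) vu = contradiction vu (not-¬ (apart v∈p u∈q))

MaxDegree-∪ : ∀ (G : Graph n) → Apart G p q → MaxDegree G p d → MaxDegree G q d → MaxDegree G (p ∪ q) d
MaxDegree-∪ {p = p} {q = q} G apart p-sparse q-sparse v∈p∪q with x∈p∪q⁻ p q v∈p∪q
... | inj₁ v∈p =
  ≤-trans (degree-mono G λ u∈p∪q → neighbour-stays G apart v∈p (x∈p∪q⁻ p q u∈p∪q)) (p-sparse v∈p)
... | inj₂ v∈q =
  ≤-trans (degree-mono G λ u∈p∪q → neighbour-stays G (Apart-sym G apart) v∈q (swap (x∈p∪q⁻ p q u∈p∪q)))
          (q-sparse v∈q)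

-- Cographs and their complements

-- Abstracts a cograph and its complement, so that exchanging the two is definitional
-- (complement (complement G) is not G itself).
record CographPair (n : ℕ) : Set where
  field
    A B       : Graph n
    A-cograph : Cograph A
    B-cograph : Cograph B
    disjoint  : ∀ {u v} → adj A u v ≡ true → adj B u v ≡ false

swapped : CographPair n → CographPair n
swapped P = record
  { A = B ; B = A ; A-cograph = B-cograph ; B-cograph = A-cograph
  ; disjoint = λ Buv → ¬-not (λ Auv → not-¬ (disjoint Auv) Buv)
  }
  where open CographPair P

complement-adj⇒nonadj : ∀ (G : Graph n) → adj (complement G) u v ≡ true → adj G u v ≡ false
complement-adj⇒nonadj {u = u} {v = v} G e with adj G u v
complement-adj⇒nonadj G e  | false = refl
complement-adj⇒nonadj G () | true

complement-nonadj⇒adj : ∀ (G : Graph n) → adj (complement G) u v ≡ false → u ≢ v → adj G u v ≡ true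
complement-nonadj⇒adj {u = u} {v = v} G e u≢v with adj G u v | u ≟ v
complement-nonadj⇒adj G e  u≢v | true  | _        = refl
complement-nonadj⇒adj G e  u≢v | false | yes u≡v = contradiction u≡v u≢v
complement-nonadj⇒adj G () u≢v | false | no _

distinct-by-adjacency : ∀ (G : Graph n) → adj G x y ≡ true → adj G u y ≡ false → x ≢ u
distinct-by-adjacency G xy uy refl = not-¬ uy xy

-- The complement of the induced path a b c d is the induced path c a d b.
complement-cograph : ∀ (G : Graph n) → Cograph G → Cograph (complement G)
complement-cograph G cograph a b c d ab bc cd ac bd ad =
  cograph c a d b G-ca G-ad G-db (complement-adj⇒nonadj G cd) (complement-adj⇒nonadj G ab) G-cb
  where
  Ḡ = complement G
  G-ca = trans (adj-sym G c a) (complement-nonadj⇒adj G ac (≢-sym (distinct-by-adjacency Ḡ cd ad)))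
  G-ad = complement-nonadj⇒adj G ad (distinct-by-adjacency Ḡ ab (trans (adj-sym Ḡ d b) bd))
  G-db = trans (adj-sym G d b) (complement-nonadj⇒adj G bd
           (distinct-by-adjacency Ḡ (trans (adj-sym Ḡ b a) ab) (trans (adj-sym Ḡ d a) ad)))
  G-cb = trans (adj-sym G c b) (complement-adj⇒nonadj G bc)

cographPair : ∀ (G : Graph n) → Cograph G → CographPair n
cographPair G cograph = record
  { A = G ; B = complement G ; A-cograph = cograph ; B-cograph = complement-cograph G cograph
  ; disjoint = λ Guv → cong (λ b → not b ∧ _) Guv
  }

-- Splitting a cograph

Isolated : Graph n → Subset n → Subset n → Set
Isolated G S C = ∀ {x y} → x ∈ C → y ∈ S → y ∉ C → adj G x y ≡ false

record Separation (G : Graph n) (S : Subset n) : Set where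
  field
    part          : Subset n
    part⊂S        : part ⊂ S
    part-nonempty : Nonempty part
    isolated      : Isolated G S part

  part⊆S : part ⊆ S
  part⊆S = proj₁ part⊂S

flipped : Separation G S → Separation G S
flipped {G = G} {S = S} sep
  with a , a∈C ← Separation.part-nonempty sep
     | b , b∈S , b∉C ← proj₂ (Separation.part⊂S sep) = record
  { part          = S ─ part
  ; part⊂S        = p─q⊆p S part , a , part⊆S a∈C , λ a∈S─C → x∈p─q⇒x∉q S part a∈S─C a∈C
  ; part-nonempty = b , x∈p∧x∉q⇒x∈p─q b∈S b∉C
  ; isolated      = λ {x} {y} x∈S─C y∈S y∉S─C →
      trans (adj-sym G x y)
            (isolated (x∈p∧x∉p─q⇒x∈q part y∈S y∉S─C) (p─q⊆p S part x∈S─C) (x∈p─q⇒x∉q S part x∈S─C))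
  }
  where open Separation sep

no-neighbours : ∀ (G : Graph n) → ¬ Nonempty (p ∩ neighbours G v) → x ∈ p → adj G v x ≡ false
no-neighbours {x = x} G none x∈p = ∉neighbours⇒nonadj G λ x∈N → none (x , x∈p∩q⁺ (x∈p , x∈N))

no-nonneighbours : ∀ (G : Graph n) → ¬ Nonempty (p ─ neighbours G v) → x ∈ p → adj G v x ≡ true
no-nonneighbours {x = x} G none x∈p = ∈neighbours⇒adj G (x∈p∧x∉p─q⇒x∈q _ x∈p λ x∈p─N → none (x , x∈p─N))

extend-nonadjacent : ∀ (G : Graph n) {C} → v ∈ S → C ⊆ S - v → Nonempty C → Isolated G (S - v) C →
  (∀ {x} → x ∈ C → adj G v x ≡ false) → Separation G S
extend-nonadjacent {v = v} {S = S} G {C} v∈S C⊆S-v C-nonempty C-isolated v≁C = record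
  { part          = C
  ; part⊂S        = p─q⊆p S ⁅ v ⁆ ∘ C⊆S-v , v , v∈S , λ v∈C → x∈p-y⇒x≢y S (C⊆S-v v∈C) refl
  ; part-nonempty = C-nonempty
  ; isolated      = isolated
  }
  where
  isolated : Isolated G S C
  isolated {x} {y} x∈C y∈S y∉C with y ≟ v
  ... | yes refl = trans (adj-sym G x y) (v≁C x∈C)
  ... | no  y≢v  = C-isolated x∈C (x∈p∧x≢y⇒x∈p-y y∈S y≢v) y∉C

extend-P4 : ∀ (G : Graph n) → Cograph G → v ∈ S → (sep : Separation G (S - v)) →
  u ∈ Separation.part sep → adj G v u ≡ false →
  w ∈ S - v → w ∉ Separation.part sep → adj G v w ≡ true → Separation G S
extend-P4 {v = v} {S = S} {u = u} {w = w} G cograph v∈S sep u∈D vu w∈S-v w∉D vw = record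
  { part          = D ─ N
  ; part⊂S        = p─q⊆p S ⁅ v ⁆ ∘ part⊆S ∘ p─q⊆p D N , v , v∈S ,
                    λ v∈D─N → x∈p-y⇒x≢y S (part⊆S (p─q⊆p D N v∈D─N)) refl
  ; part-nonempty = u , x∈p∧x∉q⇒x∈p─q u∈D (nonadj⇒∉neighbours G vu)
  ; isolated      = isolated′
  }
  where
  open Separation sep renaming (part to D; isolated to D-isolated)
  N = neighbours G v
  isolated′ : Isolated G S (D ─ N)
  isolated′ {x} {y} x∈D─N y∈S y∉D─N with y ≟ v | y ∈? D
  ... | yes refl | _       = trans (adj-sym G x y) (∉neighbours⇒nonadj G (x∈p─q⇒x∉q D N x∈D─N))
  ... | no y≢v   | no y∉D  = D-isolated (p─q⊆p D N x∈D─N) (x∈p∧x≢y⇒x∈p-y y∈S y≢v) y∉D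
  -- an edge x y would complete the induced path x y v w
  ... | no _     | yes y∈D = ¬-not λ xy → cograph x y v w xy yv vw xv yw xw
    where
    x∈D = p─q⊆p D N x∈D─N
    yv = trans (adj-sym G y v) (∈neighbours⇒adj G (x∈p∧x∉p─q⇒x∈q N y∈D y∉D─N))
    xv = trans (adj-sym G x v) (∉neighbours⇒nonadj G (x∈p─q⇒x∉q D N x∈D─N))
    yw = D-isolated y∈D w∈S-v w∉D
    xw = D-isolated x∈D w∈S-v w∉D

extend-at-part : ∀ (G : Graph n) → Cograph G → v ∈ S → (sep : Separation G (S - v)) →
  u ∈ Separation.part sep → adj G v u ≡ false → Separation G S
extend-at-part {v = v} {S = S} G cograph v∈S sep u∈D vu =
  by-cases (nonempty? ((S - v ─ D) ∩ neighbours G v))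
  where
  open Separation sep renaming (part to D)
  by-cases : Dec (Nonempty ((S - v ─ D) ∩ neighbours G v)) → Separation G S
  by-cases (yes (w , w∈rest∩N)) with w∈rest , w∈N ← x∈p∩q⁻ (S - v ─ D) _ w∈rest∩N =
    extend-P4 G cograph v∈S sep u∈D vu (p─q⊆p (S - v) D w∈rest) (x∈p─q⇒x∉q (S - v) D w∈rest)
      (∈neighbours⇒adj G w∈N)
  by-cases (no none) =
    extend-nonadjacent G v∈S (p─q⊆p (S - v) D) (Separation.part-nonempty (flipped sep))
      (Separation.isolated (flipped sep)) (no-neighbours G none)

extend : ∀ (G : Graph n) → Cograph G → v ∈ S → Separation G (S - v) →
  u ∈ S - v → adj G v u ≡ false → Separation G S
extend {u = u} G cograph v∈S sep u∈S-v vu with u ∈? Separation.part sep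
... | yes u∈D = extend-at-part G cograph v∈S sep u∈D vu
... | no  u∉D = extend-at-part G cograph v∈S (flipped sep) (x∈p∧x∉q⇒x∈p─q u∈S-v u∉D) vu

nonempty-after-removal : v ∈ S → 2 ≤ ∣ S ∣ → Nonempty (S - v)
nonempty-after-removal {v = v} {S = S} v∈S 2≤∣S∣ =
  0<∣p∣⇒Nonempty (S - v) (s≤s⁻¹ (subst (2 ≤_) (x∈p⇒∣p∣≡1+∣p-x∣ v∈S) 2≤∣S∣))

module _ (P : CographPair n) where
  open CographPair P

  separation-step : v ∈ S → 2 ≤ ∣ S ∣ → (2 ≤ ∣ S - v ∣ → Separation A (S - v) ⊎ Separation B (S - v)) →
    Separation A S ⊎ Separation B S
  separation-step {v = v} {S = S} v∈S 2≤∣S∣ separate-rest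
    with nonempty? ((S - v) ∩ neighbours A v) | nonempty? ((S - v) ─ neighbours A v)
  ... | no none | _ =
    inj₁ (extend-nonadjacent A v∈S ⊆-refl (nonempty-after-removal v∈S 2≤∣S∣) (λ _ → contradiction)
           (no-neighbours A none))
  ... | yes _ | no none =
    inj₂ (extend-nonadjacent B v∈S ⊆-refl (nonempty-after-removal v∈S 2≤∣S∣) (λ _ → contradiction)
           (disjoint ∘ no-nonneighbours A none))
  ... | yes (w , w∈S-v∩N) | yes (u , u∈S-v─N) =
    Sum.map (λ sep → extend A A-cograph v∈S sep u∈S-v vu)
            (λ sep → extend B B-cograph v∈S sep w∈S-v (disjoint vw))
            (separate-rest (two-elements⇒2≤∣p∣ w∈S-v u∈S-v u≢w))
    where
    w∈S-v = proj₁ (x∈p∩q⁻ (S - v) _ w∈S-v∩N)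
    vw = ∈neighbours⇒adj A (proj₂ (x∈p∩q⁻ (S - v) _ w∈S-v∩N))
    u∈S-v = p─q⊆p (S - v) _ u∈S-v─N
    vu = ∉neighbours⇒nonadj A (x∈p─q⇒x∉q (S - v) _ u∈S-v─N)
    u≢w : u ≢ w
    u≢w refl = not-¬ vu vw

  separation : ∀ S → Acc _≺_ S → 2 ≤ ∣ S ∣ → Separation A S ⊎ Separation B S
  separation S (acc rec) 2≤∣S∣ with v , v∈S ← 0<∣p∣⇒Nonempty S (≤-trans (s≤s z≤n) 2≤∣S∣) =
    separation-step v∈S 2≤∣S∣ (separation (S - v) (rec (x∈p⇒∣p-x∣<∣p∣ v∈S)))

m*[a+b]≤[x+z]*t : ∀ m a b x z {y w t} →
  m * a ≤ x * y → m * b ≤ z * w → y ≤ t → w ≤ t → m * (a + b) ≤ (x + z) * t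
m*[a+b]≤[x+z]*t m a b x z {y} {w} {t} ma≤xy mb≤zw y≤t w≤t = begin
  m * (a + b)    ≡⟨ *-distribˡ-+ m a b ⟩
  m * a + m * b  ≤⟨ +-mono-≤ ma≤xy mb≤zw ⟩
  x * y + z * w  ≤⟨ +-mono-≤ (*-monoʳ-≤ x y≤t) (*-monoʳ-≤ z w≤t) ⟩
  x * t + z * t  ≡⟨ *-distribʳ-+ t x z ⟨
  (x + z) * t    ∎
  where open ≤-Reasoning

-- Y may lie in a larger set U than T: a part smaller than m borrows Y from the whole set.
record Witness (P : CographPair n) (d m : ℕ) (T U : Subset n) : Set where
  field
    X Y      : Subset n
    X⊆T      : X ⊆ T
    Y⊆U      : Y ⊆ U
    X-sparse : MaxDegree (CographPair.A P) X d
    Y-sparse : MaxDegree (CographPair.B P) Y d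
    product  : m * ∣ T ∣ ≤ ∣ X ∣ * ∣ Y ∣

module _ {P : CographPair n} where
  open CographPair P

  swap-witness : Witness (swapped P) d m S S → Witness P d m S S
  swap-witness {m = m} {S = S} w = record
    { X = Y ; Y = X ; X⊆T = Y⊆U ; Y⊆U = X⊆T ; X-sparse = Y-sparse ; Y-sparse = X-sparse
    ; product = subst (m * ∣ S ∣ ≤_) (*-comm (∣ X ∣) (∣ Y ∣)) product
    }
    where open Witness w

  weaken : T ⊆ U → Witness P d m T T → Witness P d m T U
  weaken T⊆U w = record
    { X = X ; Y = Y ; X⊆T = X⊆T ; Y⊆U = T⊆U ∘ Y⊆U
    ; X-sparse = X-sparse ; Y-sparse = Y-sparse ; product = product
    }
    where open Witness w

  witness-small : ∣ S ∣ ≤ suc d → m ≤ ∣ S ∣ → Witness P d m S S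
  witness-small {S = S} ∣S∣≤1+d m≤∣S∣ = record
    { X = S ; Y = S ; X⊆T = ⊆-refl ; Y⊆U = ⊆-refl
    ; X-sparse = small⇒MaxDegree A ∣S∣≤1+d ; Y-sparse = small⇒MaxDegree B ∣S∣≤1+d
    ; product = *-monoˡ-≤ ∣ S ∣ m≤∣S∣
    }

  witness-small-part : m ≤ suc d → ∣ T ∣ < m → m ≤ ∣ U ∣ → Witness P d m T U
  witness-small-part {m = m} {d = d} {T = T} {U = U} m≤1+d ∣T∣<m m≤∣U∣
    with Y , Y⊆U , ∣Y∣≡m ← subset-of-size U m≤∣U∣ = record
    { X = T ; Y = Y ; X⊆T = ⊆-refl ; Y⊆U = Y⊆U
    ; X-sparse = small⇒MaxDegree A (≤-trans (<⇒≤ ∣T∣<m) m≤1+d)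
    ; Y-sparse = small⇒MaxDegree B (subst (_≤ suc d) (sym ∣Y∣≡m) m≤1+d)
    ; product = ≤-reflexive (trans (*-comm m ∣ T ∣) (cong (∣ T ∣ *_) (sym ∣Y∣≡m)))
    }

  witness-∪ : (sep : Separation A S) → Witness P d m (Separation.part sep) S →
    Witness P d m (S ─ Separation.part sep) S → Witness P d m S S
  witness-∪ {S = S} {d = d} {m = m} sep w₁ w₂ =
    from-larger (larger (λ Y → Y ⊆ S × MaxDegree B Y d) (W₁.Y⊆U , W₁.Y-sparse) (W₂.Y⊆U , W₂.Y-sparse))
    where
    open Separation sep renaming (part to C)
    module W₁ = Witness w₁
    module W₂ = Witness w₂

    X₂⊆S : W₂.X ⊆ S
    X₂⊆S = p─q⊆p S C ∘ W₂.X⊆T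

    X₂∩C=∅ : ∀ {x} → x ∈ W₂.X → x ∉ C
    X₂∩C=∅ = x∈p─q⇒x∉q S C ∘ W₂.X⊆T

    from-larger : Σ[ Y ∈ Subset n ] (Y ⊆ S × MaxDegree B Y d) × ∣ W₁.Y ∣ ≤ ∣ Y ∣ × ∣ W₂.Y ∣ ≤ ∣ Y ∣ →
      Witness P d m S S
    from-larger (Y , (Y⊆S , Y-sparse) , ∣Y₁∣≤∣Y∣ , ∣Y₂∣≤∣Y∣) = record
      { X        = W₁.X ∪ W₂.X
      ; Y        = Y
      ; X⊆T      = p⊆r∧q⊆r⇒p∪q⊆r W₁.X W₂.X (part⊆S ∘ W₁.X⊆T) X₂⊆S
      ; Y⊆U      = Y⊆S
      ; X-sparse = MaxDegree-∪ A (λ x∈X₁ y∈X₂ → isolated (W₁.X⊆T x∈X₁) (X₂⊆S y∈X₂) (X₂∩C=∅ y∈X₂))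
                     W₁.X-sparse W₂.X-sparse
      ; Y-sparse = Y-sparse
      ; product  = subst₂ (λ s x → m * s ≤ x * ∣ Y ∣)
                     (sym (p⊆q⇒∣q∣≡∣p∣+∣q─p∣ C S part⊆S))
                     (sym (∣p∪q∣≡∣p∣+∣q∣ W₁.X W₂.X λ x∈X₁ x∈X₂ → X₂∩C=∅ x∈X₂ (W₁.X⊆T x∈X₁)))
                     (m*[a+b]≤[x+z]*t m (∣ C ∣) (∣ S ─ C ∣) (∣ W₁.X ∣) (∣ W₂.X ∣)
                        W₁.product W₂.product ∣Y₁∣≤∣Y∣ ∣Y₂∣≤∣Y∣)
      }

witness : ∀ (P : CographPair n) → m ≤ suc d → ∀ S → Acc _≺_ S → m ≤ ∣ S ∣ → Witness P d m S S
witness {m = m} {d = d} P m≤1+d S (acc rec) m≤∣S∣ = by-size (∣ S ∣ ≤? suc d)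
  where
  part-witness : ∀ Q {T} → T ⊂ S → Witness Q d m T S
  part-witness Q {T} T⊂S with m ≤? ∣ T ∣
  ... | yes m≤∣T∣ = weaken (proj₁ T⊂S) (witness Q m≤1+d T (rec (p⊂q⇒∣p∣<∣q∣ T⊂S)) m≤∣T∣)
  ... | no  m≰∣T∣ = witness-small-part m≤1+d (≰⇒> m≰∣T∣) m≤∣S∣

  from-separation : ∀ Q → Separation (CographPair.A Q) S → Witness Q d m S S
  from-separation Q sep =
    witness-∪ sep (part-witness Q (Separation.part⊂S sep))
                  (part-witness Q (Separation.part⊂S (flipped sep)))

  by-size : Dec (∣ S ∣ ≤ suc d) → Witness P d m S S
  by-size (yes ∣S∣≤1+d) = witness-small ∣S∣≤1+d m≤∣S∣
  by-size (no  ∣S∣≰1+d) =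
    [ from-separation P , swap-witness ∘ from-separation (swapped P) ]′
      (separation P S (acc rec) (≤-trans (s≤s (s≤s z≤n)) (≰⇒> ∣S∣≰1+d)))

-- Choosing d and m

q*[k/q]≤k : ∀ k q .{{_ : NonZero q}} → q * (k / q) ≤ k
q*[k/q]≤k k q = subst (_≤ k) (*-comm (k / q) q) (m/n*n≤m k q)

k<q*[1+k/q] : ∀ k q .{{_ : NonZero q}} → k < q * suc (k / q)
k<q*[1+k/q] k q = begin-strict
  k                   ≡⟨ m≡m%n+[m/n]*n k q ⟩
  k % q + (k / q) * q <⟨ +-monoˡ-< ((k / q) * q) (m%n<n k q) ⟩
  q + (k / q) * q     ≡⟨ *-comm (suc (k / q)) q ⟩
  q * suc (k / q)     ∎
  where open ≤-Reasoning

threshold : ∀ a b n .{{_ : NonZero b}} → a ≤ b → a * n ≤ b * (n ⊓ suc (a * n / b))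
threshold a b n a≤b = begin
  a * n                            ≤⟨ ⊓-glb (*-monoˡ-≤ n a≤b) (<⇒≤ (k<q*[1+k/q] (a * n) b)) ⟩
  (b * n) ⊓ (b * suc (a * n / b))  ≡⟨ *-distribˡ-⊓ b n (suc (a * n / b)) ⟨
  b * (n ⊓ suc (a * n / b))        ∎
  where open ≤-Reasoning

MaxDegree⇒MaxDegAtMost : ∀ (G : Graph n) {X} a b → b * d ≤ a * n → MaxDegree G X d → MaxDegAtMost G X a b
MaxDegree⇒MaxDegAtMost {n = n} {d = d} G {X} a b bd≤an sparse v v∈X = begin
  b * degIn G X v   ≡⟨ cong (b *_) (degIn≡degree G X v) ⟩
  b * degree G X v  ≤⟨ *-monoʳ-≤ b (sparse (lookup⇒[]= v X v∈X)) ⟩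
  b * d             ≤⟨ bd≤an ⟩
  a * n             ∎
  where open ≤-Reasoning

mainTheorem8 : (n : ℕ) (G : Graph n) → Cograph G →
    (p q : ℕ) → 0 < q → p ≤ q →
    Σ[ X ∈ Subset n ] Σ[ Y ∈ Subset n ]
    (MaxDegAtMost G X p q × MaxDegAtMost (complement G) Y p q ×
    p * (n * n) ≤ q * (∣ X ∣ * ∣ Y ∣))
mainTheorem8 n G cograph p q 0<q p≤q =
  X , Y ,
  MaxDegree⇒MaxDegAtMost G p q qd≤pn X-sparse ,
  MaxDegree⇒MaxDegAtMost (complement G) p q qd≤pn Y-sparse ,
  size
  where
  instance
    q≢0 : NonZero q
    q≢0 = >-nonZero 0<q
  δ = p * n / q
  μ = n ⊓ suc δ
  qd≤pn = q*[k/q]≤k (p * n) q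
  open Witness (witness (cographPair G cograph) (m⊓n≤n n (suc δ)) (⊤ {n}) (≺-wellFounded ⊤)
                         (subst (μ ≤_) (sym (∣⊤∣≡n n)) (m⊓n≤m n (suc δ))))
  open ≤-Reasoning
  size : p * (n * n) ≤ q * (∣ X ∣ * ∣ Y ∣)
  size = begin
    p * (n * n)          ≡⟨ *-assoc p n n ⟨
    p * n * n            ≤⟨ *-monoˡ-≤ n (threshold p q n p≤q) ⟩
    q * μ * n            ≡⟨ *-assoc q μ n ⟩
    q * (μ * n)          ≡⟨ cong (λ k → q * (μ * k)) (∣⊤∣≡n n) ⟨
    q * (μ * ∣ ⊤ {n} ∣)  ≤⟨ *-monoʳ-≤ q product ⟩
    q * (∣ X ∣ * ∣ Y ∣)  ∎
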